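{- For every positive integer $n$ and every integer $k \ge \lfloor \lg n \rfloor + 1$, \[ 2^k\, \tilde{F}\!\left(\frac{n}{2^k}\right) \;=\; \sum_{i=1}^{k} 2^i\, \mathrm{Zigzag}\!\left(\frac{n}{2^i}\right). \]
   Context: $\lg$ is the logarithm to base 2. For a real number $x$, $\mathrm{Zigzag}(x) = \min\left(x - \lfloor x \rfloor,\ \lceil x \rceil - x\right)$. The function $\tilde{F}:\mathbb{R}\to\mathbb{R}$ is $\tilde{F}(x) = \sum_{i=0}^{\infty} 2^{ -i}\, \mathrm{Zigzag}(2^i x)$. -}

module Defs where

open import Data.Nat as ℕ using (ℕ; zero; suc)
open import Data.Integer as ℤ using (ℤ; +_)
open import Data.Rational
open import Data.Product using (∃; _×_)

toℚ : ℤ → ℚ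
toℚ z = z / 1

ℕtoℚ : ℕ → ℚ
ℕtoℚ n = + n / 1

two^ : ℕ → ℚ
two^ zero    = 1ℚ
two^ (suc i) = ℕtoℚ 2 * two^ i

half^ : ℕ → ℚ
half^ zero    = 1ℚ
half^ (suc i) = ½ * half^ i

Zigzag : ℚ → ℚ
Zigzag x = (x - toℚ (floor x)) ⊓ (toℚ (ceiling x) - x)

sumFrom : ℕ → ℕ → (ℕ → ℚ) → ℚ
sumFrom a zero    f = 0ℚ
sumFrom a (suc m) f = f a + sumFrom (suc a) m f

partialSum : (ℕ → ℚ) → ℕ → ℚ
partialSum f m = sumFrom 0 m f

HasSum : (ℕ → ℚ) → ℚ → Set
HasSum f L = ∀ (ε : ℚ) → 0ℚ < ε →
  ∃ λ (N : ℕ) → ∀ (m : ℕ) → N ℕ.≤ m → ∣ partialSum f m - L ∣ < ε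

F̃term : ℚ → ℕ → ℚ
F̃term x i = half^ i * Zigzag (two^ i * x)

-- "F̃(x) = y": the series Σ_i 2^{-i} Zigzag(2^i x) sums to y
F̃≡ : ℚ → ℚ → Set
F̃≡ x y = HasSum (F̃term x) y

-- Every term of the series at x = n / 2^k with index i ≥ k vanishes, since 2^i x is then an
-- integer; so F̃(x) is the finite sum of its first k terms.  Multiplying the i-th of these by
-- 2^k turns it into 2^(k-i) Zigzag(n / 2^(k-i)), and reversing the order of summation gives
-- the right-hand side.
module Submission where

open import Defs
open import Data.Nat as ℕ using (ℕ; zero; suc; _≤_; z≤n; s≤s)
open import Data.Nat.Logarithm using (⌊log₂_⌋)
import Data.Nat.Properties as ℕ
import Data.Nat.DivMod as ℕ
import Data.Nat.Coprimality as Coprimality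
import Data.Integer as ℤ
import Data.Integer.Properties as ℤ
open import Data.Rational using (ℚ; mkℚ; _/_; _*_; _+_; _-_; ½; 0ℚ; 1ℚ; floor; ceiling; _<_; ∣_∣)
open import Data.Rational.Properties
open import Algebra.Bundles using (CommutativeMonoid)
open import Algebra.Properties.CommutativeSemigroup
  (CommutativeMonoid.commutativeSemigroup *-1-commutativeMonoid) using (interchange)
open import Data.Product using (∃; _×_; _,_)
open import Data.Sum using (inj₁; inj₂)
open import Relation.Binary.PropositionalEquality

ℕtoℚ-mkℚ : ∀ m → ℕtoℚ m ≡ mkℚ (ℤ.+ m) 0 (Coprimality.sym (Coprimality.1-coprimeTo m))
ℕtoℚ-mkℚ m = ↥p/↧p≡p _

ℕtoℚ-* : ∀ a b → ℕtoℚ a * ℕtoℚ b ≡ ℕtoℚ (a ℕ.* b)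
ℕtoℚ-* a b rewrite ℕtoℚ-mkℚ a | ℕtoℚ-mkℚ b = cong (λ z → z / 1) (ℤ.◃-inverse (ℤ.+ (a ℕ.* b)))

floor-ℕtoℚ : ∀ m → floor (ℕtoℚ m) ≡ ℤ.+ m
floor-ℕtoℚ m rewrite ℕtoℚ-mkℚ m = trans (ℤ.*-identityˡ _) (cong ℤ.+_ (ℕ.n/1≡n m))

ceiling-ℕtoℚ : ∀ m → ceiling (ℕtoℚ m) ≡ ℤ.+ m
ceiling-ℕtoℚ zero = refl
-- ceiling negates, and ℤ._/ℕ_ on a negative numerator branches on the remainder.
ceiling-ℕtoℚ (suc m) rewrite ℕtoℚ-mkℚ (suc m) with suc m ℕ.% 1 | ℕ.n%1≡0 (suc m)
... | .0 | refl =
  trans (cong ℤ.-_ (ℤ.*-identityˡ _)) (trans (ℤ.neg-involutive _) (cong ℤ.+_ (ℕ.n/1≡n (suc m))))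

Zigzag-ℕtoℚ : ∀ m → Zigzag (ℕtoℚ m) ≡ 0ℚ
Zigzag-ℕtoℚ m rewrite floor-ℕtoℚ m | ceiling-ℕtoℚ m | +-inverseʳ (ℕtoℚ m) = refl

two^-+ : ∀ i j → two^ (i ℕ.+ j) ≡ two^ i * two^ j
two^-+ zero    j = sym (*-identityˡ (two^ j))
two^-+ (suc i) j = trans (cong (ℕtoℚ 2 *_) (two^-+ i j)) (sym (*-assoc (ℕtoℚ 2) (two^ i) (two^ j)))

half^-+ : ∀ i j → half^ (i ℕ.+ j) ≡ half^ i * half^ j
half^-+ zero    j = sym (*-identityˡ (half^ j))
half^-+ (suc i) j = trans (cong (½ *_) (half^-+ i j)) (sym (*-assoc ½ (half^ i) (half^ j)))

two^*half^≡1 : ∀ i → two^ i * half^ i ≡ 1ℚ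
two^*half^≡1 zero    = refl
two^*half^≡1 (suc i) = trans (interchange (ℕtoℚ 2) (two^ i) ½ (half^ i))
                             (cong (1ℚ *_) (two^*half^≡1 i))

two^-+*half^ : ∀ i j → two^ (i ℕ.+ j) * half^ i ≡ two^ j
two^-+*half^ i j = begin
  two^ (i ℕ.+ j) * half^ i   ≡⟨ cong (_* half^ i) (two^-+ i j) ⟩
  two^ i * two^ j * half^ i  ≡⟨ *-assoc (two^ i) (two^ j) (half^ i) ⟩
  two^ i * (two^ j * half^ i) ≡⟨ cong (two^ i *_) (*-comm (two^ j) (half^ i)) ⟩
  two^ i * (half^ i * two^ j) ≡⟨ *-assoc (two^ i) (half^ i) (two^ j) ⟨
  two^ i * half^ i * two^ j  ≡⟨ cong (_* two^ j) (two^*half^≡1 i) ⟩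
  1ℚ * two^ j                ≡⟨ *-identityˡ (two^ j) ⟩
  two^ j                     ∎
  where open ≡-Reasoning

two^*half^-+ : ∀ i j → two^ i * half^ (i ℕ.+ j) ≡ half^ j
two^*half^-+ i j = begin
  two^ i * half^ (i ℕ.+ j)   ≡⟨ cong (two^ i *_) (half^-+ i j) ⟩
  two^ i * (half^ i * half^ j) ≡⟨ *-assoc (two^ i) (half^ i) (half^ j) ⟨
  two^ i * half^ i * half^ j ≡⟨ cong (_* half^ j) (two^*half^≡1 i) ⟩
  1ℚ * half^ j               ≡⟨ *-identityˡ (half^ j) ⟩
  half^ j                    ∎
  where open ≡-Reasoning

two^*ℕtoℚ : ∀ j m → two^ j * ℕtoℚ m ≡ ℕtoℚ (2 ℕ.^ j ℕ.* m)
two^*ℕtoℚ zero    m = trans (*-identityˡ (ℕtoℚ m)) (cong ℕtoℚ (sym (ℕ.+-identityʳ m)))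
two^*ℕtoℚ (suc j) m = begin
  ℕtoℚ 2 * two^ j * ℕtoℚ m          ≡⟨ *-assoc (ℕtoℚ 2) (two^ j) (ℕtoℚ m) ⟩
  ℕtoℚ 2 * (two^ j * ℕtoℚ m)        ≡⟨ cong (ℕtoℚ 2 *_) (two^*ℕtoℚ j m) ⟩
  ℕtoℚ 2 * ℕtoℚ (2 ℕ.^ j ℕ.* m)     ≡⟨ ℕtoℚ-* 2 (2 ℕ.^ j ℕ.* m) ⟩
  ℕtoℚ (2 ℕ.* (2 ℕ.^ j ℕ.* m))      ≡⟨ cong ℕtoℚ (ℕ.*-assoc 2 (2 ℕ.^ j) m) ⟨
  ℕtoℚ (2 ℕ.^ suc j ℕ.* m)          ∎
  where open ≡-Reasoning

sumFrom-cong : ∀ (f g : ℕ → ℚ) a m → (∀ i → a ≤ i → i ℕ.< a ℕ.+ m → f i ≡ g i) →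
               sumFrom a m f ≡ sumFrom a m g
sumFrom-cong f g a zero    f≗g = refl
sumFrom-cong f g a (suc m) f≗g rewrite ℕ.+-suc a m =
  cong₂ _+_ (f≗g a ℕ.≤-refl (s≤s (ℕ.m≤m+n a m)))
            (sumFrom-cong f g (suc a) m λ i a<i i<a+m → f≗g i (ℕ.<⇒≤ a<i) i<a+m)

*-distribˡ-sumFrom : ∀ c (f : ℕ → ℚ) a m → c * sumFrom a m f ≡ sumFrom a m (λ i → c * f i)
*-distribˡ-sumFrom c f a zero    = *-zeroʳ c
*-distribˡ-sumFrom c f a (suc m) =
  trans (*-distribˡ-+ c _ _) (cong (c * f a +_) (*-distribˡ-sumFrom c f (suc a) m))

sumFrom-suc : ∀ (f : ℕ → ℚ) a m → sumFrom a (suc m) f ≡ sumFrom a m f + f (a ℕ.+ m)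
sumFrom-suc f a zero rewrite ℕ.+-identityʳ a = trans (+-identityʳ (f a)) (sym (+-identityˡ (f a)))
sumFrom-suc f a (suc m) rewrite ℕ.+-suc a m =
  trans (cong (f a +_) (sumFrom-suc f (suc a) m)) (sym (+-assoc (f a) _ _))

sumFrom-shift : ∀ (f : ℕ → ℚ) a m → sumFrom (suc a) m f ≡ sumFrom a m (λ i → f (suc i))
sumFrom-shift f a zero    = refl
sumFrom-shift f a (suc m) = cong (f (suc a) +_) (sumFrom-shift f (suc a) m)

sumFrom-reverse : ∀ (g : ℕ → ℚ) k → sumFrom 0 k (λ i → g (k ℕ.∸ i)) ≡ sumFrom 1 k g
sumFrom-reverse g zero    = refl
sumFrom-reverse g (suc k) = begin
  g (suc k) + sumFrom 1 k (λ i → g (suc k ℕ.∸ i)) ≡⟨ cong (g (suc k) +_) (sumFrom-shift _ 0 k) ⟩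
  g (suc k) + sumFrom 0 k (λ i → g (k ℕ.∸ i))     ≡⟨ cong (g (suc k) +_) (sumFrom-reverse g k) ⟩
  g (suc k) + sumFrom 1 k g                       ≡⟨ +-comm (g (suc k)) _ ⟩
  sumFrom 1 k g + g (suc k)                       ≡⟨ sumFrom-suc g 1 k ⟨
  sumFrom 1 (suc k) g                             ∎
  where open ≡-Reasoning

partialSum-stable : ∀ (f : ℕ → ℚ) k → (∀ i → k ≤ i → f i ≡ 0ℚ) →
                    ∀ m → k ≤ m → partialSum f m ≡ partialSum f k
partialSum-stable f k f≡0 zero    z≤n = refl
partialSum-stable f k f≡0 (suc m) k≤1+m with ℕ.m≤n⇒m<n∨m≡n k≤1+m
... | inj₂ refl      = refl
... | inj₁ (s≤s k≤m) = begin
  partialSum f (suc m)   ≡⟨ sumFrom-suc f 0 m ⟩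
  partialSum f m + f m   ≡⟨ cong (partialSum f m +_) (f≡0 m k≤m) ⟩
  partialSum f m + 0ℚ    ≡⟨ +-identityʳ _ ⟩
  partialSum f m         ≡⟨ partialSum-stable f k f≡0 m k≤m ⟩
  partialSum f k         ∎
  where open ≡-Reasoning

HasSum-eventually-zero : ∀ (f : ℕ → ℚ) k → (∀ i → k ≤ i → f i ≡ 0ℚ) → HasSum f (partialSum f k)
HasSum-eventually-zero f k f≡0 ε 0<ε = k , λ m k≤m →
  subst (λ s → ∣ s - partialSum f k ∣ < ε) (sym (partialSum-stable f k f≡0 m k≤m))
        (subst (λ d → ∣ d ∣ < ε) (sym (+-inverseʳ (partialSum f k))) 0<ε)

F̃term-dyadic-vanishes : ∀ n k i → k ≤ i → F̃term (ℕtoℚ n * half^ k) i ≡ 0ℚ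
F̃term-dyadic-vanishes n k i k≤i with ℕ.m≤n⇒∃[o]m+o≡n k≤i
... | j , refl = begin
  half^ (k ℕ.+ j) * Zigzag (two^ (k ℕ.+ j) * (ℕtoℚ n * half^ k))
    ≡⟨ cong (λ x → half^ (k ℕ.+ j) * Zigzag x) 2^[k+j]n/2^k≡2^jn ⟩
  half^ (k ℕ.+ j) * Zigzag (ℕtoℚ (2 ℕ.^ j ℕ.* n))
    ≡⟨ cong (half^ (k ℕ.+ j) *_) (Zigzag-ℕtoℚ (2 ℕ.^ j ℕ.* n)) ⟩
  half^ (k ℕ.+ j) * 0ℚ
    ≡⟨ *-zeroʳ (half^ (k ℕ.+ j)) ⟩
  0ℚ ∎
  where
  open ≡-Reasoning
  2^[k+j]n/2^k≡2^jn : two^ (k ℕ.+ j) * (ℕtoℚ n * half^ k) ≡ ℕtoℚ (2 ℕ.^ j ℕ.* n)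
  2^[k+j]n/2^k≡2^jn = begin
    two^ (k ℕ.+ j) * (ℕtoℚ n * half^ k) ≡⟨ cong (two^ (k ℕ.+ j) *_) (*-comm (ℕtoℚ n) (half^ k)) ⟩
    two^ (k ℕ.+ j) * (half^ k * ℕtoℚ n) ≡⟨ *-assoc (two^ (k ℕ.+ j)) (half^ k) (ℕtoℚ n) ⟨
    two^ (k ℕ.+ j) * half^ k * ℕtoℚ n   ≡⟨ cong (_* ℕtoℚ n) (two^-+*half^ k j) ⟩
    two^ j * ℕtoℚ n                     ≡⟨ two^*ℕtoℚ j n ⟩
    ℕtoℚ (2 ℕ.^ j ℕ.* n)                ∎

two^*F̃term-dyadic : ∀ x k i → i ≤ k →
  two^ k * F̃term (x * half^ k) i ≡ two^ (k ℕ.∸ i) * Zigzag (x * half^ (k ℕ.∸ i))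
two^*F̃term-dyadic x k i i≤k with ℕ.m≤n⇒∃[o]m+o≡n i≤k
... | j , refl rewrite ℕ.m+n∸m≡n i j = begin
  two^ (i ℕ.+ j) * (half^ i * Zigzag (two^ i * (x * half^ (i ℕ.+ j))))
    ≡⟨ cong (λ y → two^ (i ℕ.+ j) * (half^ i * Zigzag y)) 2^i[x/2^[i+j]]≡x/2^j ⟩
  two^ (i ℕ.+ j) * (half^ i * Zigzag (x * half^ j))
    ≡⟨ *-assoc (two^ (i ℕ.+ j)) (half^ i) _ ⟨
  two^ (i ℕ.+ j) * half^ i * Zigzag (x * half^ j)
    ≡⟨ cong (_* Zigzag (x * half^ j)) (two^-+*half^ i j) ⟩
  two^ j * Zigzag (x * half^ j) ∎
  where
  open ≡-Reasoning
  2^i[x/2^[i+j]]≡x/2^j : two^ i * (x * half^ (i ℕ.+ j)) ≡ x * half^ j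
  2^i[x/2^[i+j]]≡x/2^j = begin
    two^ i * (x * half^ (i ℕ.+ j)) ≡⟨ *-assoc (two^ i) x _ ⟨
    two^ i * x * half^ (i ℕ.+ j)   ≡⟨ cong (_* half^ (i ℕ.+ j)) (*-comm (two^ i) x) ⟩
    x * two^ i * half^ (i ℕ.+ j)   ≡⟨ *-assoc x (two^ i) _ ⟩
    x * (two^ i * half^ (i ℕ.+ j)) ≡⟨ cong (x *_) (two^*half^-+ i j) ⟩
    x * half^ j                    ∎

lemma9p4 : ∀ (n : ℕ) → 1 ≤ n → ∀ (k : ℕ) → suc ⌊log₂ n ⌋ ≤ k →
    ∃ λ (y : ℚ) → F̃≡ (ℕtoℚ n * half^ k) y
      × two^ k * y ≡ sumFrom 1 k (λ i → two^ i * Zigzag (ℕtoℚ n * half^ i))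
lemma9p4 n _ k _ = partialSum f k , HasSum-eventually-zero f k (F̃term-dyadic-vanishes n k) , scaled
  where
  open ≡-Reasoning
  f : ℕ → ℚ
  f = F̃term (ℕtoℚ n * half^ k)
  g : ℕ → ℚ
  g i = two^ i * Zigzag (ℕtoℚ n * half^ i)
  scaled : two^ k * partialSum f k ≡ sumFrom 1 k g
  scaled = begin
    two^ k * partialSum f k             ≡⟨ *-distribˡ-sumFrom (two^ k) f 0 k ⟩
    sumFrom 0 k (λ i → two^ k * f i)    ≡⟨ sumFrom-cong _ _ 0 k (λ i _ i<k →
                                             two^*F̃term-dyadic (ℕtoℚ n) k i (ℕ.<⇒≤ i<k)) ⟩
    sumFrom 0 k (λ i → g (k ℕ.∸ i))     ≡⟨ sumFrom-reverse g k ⟩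
    sumFrom 1 k g                       ∎
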